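{- Let $t:[n]\to[n]$ and $\pi:[k]\to[k]$ be permutations. Then $t$ contains $\pi$ if and only if there exists a valid embedding $f:S_\pi\to S_t$.
   Context: $[n]=\{1,\dots,n\}$. $t$ contains $\pi$ if there are indices $1\le i_1<\dots<i_k\le n$ with $t(i_j)<t(i_\ell)\iff\pi(j)<\pi(\ell)$ for all $j,\ell\in[k]$. For a permutation $\sigma$ of $[m]$, $S_\sigma=\{(i,\sigma(i)):1\le i\le m\}$; for $p\in S_\sigma$ write $p.x$ for its first coordinate and $p.y$ for its second. Neighbors of $(x,y)\in S_\sigma$: $N^R((x,y))=(x+1,\sigma(x+1))$, $N^L((x,y))=(x-1,\sigma(x-1))$, $N^U((x,y))=(\sigma^{ -1}(y+1),y+1)$, $N^D((x,y))=(\sigma^{ -1}(y-1),y-1)$; when an index is out of range the neighbor is a virtual point not in $S_\sigma$ ($N^R(m,i)=N^U(i,m)=(\infty,\infty)$, $N^L(1,i)=N^D(i,1)=(0,0)$). A function $f:S_\pi\to S_t$ is a valid embedding if for every $p\in S_\pi$: $f(N^L(p)).x<f(p).x<f(N^R(p)).x$ and $f(N^D(p)).y<f(p).y<f(N^U(p)).y$, where each inequality is required only when the corresponding neighbor belongs to $S_\pi$. -}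

module Defs where

open import Data.Nat using (ℕ; suc)
open import Data.Fin using (Fin; toℕ; _<_)
open import Data.Fin.Permutation using (Permutation′; _⟨$⟩ʳ_)
open import Data.Product using (Σ; _×_; _,_; proj₁; proj₂; ∃)
open import Relation.Binary.PropositionalEquality using (_≡_)
open import Function.Bundles using (_⇔_)

-- Points of [m] are represented 0-indexed by Fin m (order-isomorphic to [m]).

Contains : {n k : ℕ} → Permutation′ n → Permutation′ k → Set
Contains {n} {k} t π =
  ∃ λ (i : Fin k → Fin n) →
    (∀ j l → j < l → i j < i l) ×
    (∀ j l → (t ⟨$⟩ʳ i j < t ⟨$⟩ʳ i l) ⇔ (π ⟨$⟩ʳ j < π ⟨$⟩ʳ l))

S : {m : ℕ} → Permutation′ m → Set
S {m} σ = Σ (Fin m × Fin m) λ p → σ ⟨$⟩ʳ proj₁ p ≡ proj₂ p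

module _ {m : ℕ} (σ : Permutation′ m) where
  px : S σ → Fin m
  px p = proj₁ (proj₁ p)

  py : S σ → Fin m
  py p = proj₂ (proj₁ p)

  IsNR IsNL IsNU IsND : S σ → S σ → Set
  IsNR p q = toℕ (px q) ≡ suc (toℕ (px p))
  IsNL p q = suc (toℕ (px q)) ≡ toℕ (px p)
  IsNU p q = toℕ (py q) ≡ suc (toℕ (py p))
  IsND p q = suc (toℕ (py q)) ≡ toℕ (py p)

-- valid embedding: the inequalities are required only for neighbours lying in S_π
ValidEmbedding : {n k : ℕ} (t : Permutation′ n) (π : Permutation′ k) → (S π → S t) → Set
ValidEmbedding t π f =
  ∀ (p : S π) →
    (∀ q → IsNL π p q → px t (f q) < px t (f p)) ×
    (∀ q → IsNR π p q → px t (f p) < px t (f q)) ×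
    (∀ q → IsND π p q → py t (f q) < py t (f p)) ×
    (∀ q → IsNU π p q → py t (f p) < py t (f q))

-- The neighbour conditions only compare consecutive points, but that suffices: a map on
-- Fin k that increases along successors is strictly increasing (and so reflects <). Given a
-- valid embedding f, the x-conditions make x ↦ (f (x, π x)).x increasing, which yields the
-- occurrence indices, and the y-conditions make y ↦ (f (π⁻¹ y, y)).y increasing; as both
-- parametrisations reach the same points of S_π, t ∘ i factors as this increasing map after π,
-- which is exactly the order-isomorphism required of an occurrence.
module Submission where

open import Defs
open import Data.Nat as ℕ using (ℕ; zero; suc)
open import Data.Nat.Properties using (m<1+n⇒m<n∨m≡n; ≤-reflexive)
open import Data.Product using (∃; _,_; proj₁; proj₂)
open import Data.Sum using (inj₁; inj₂)
open import Data.Fin using (Fin; toℕ; inject₁; _<_)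
open import Data.Fin.Properties using (toℕ-inject₁; <-cmp; <-trans; <-asym; <-irrefl; _≟_)
open import Data.Fin.Induction using (<-weakInduction)
open import Data.Fin.Permutation using (Permutation′; _⟨$⟩ʳ_; _⟨$⟩ˡ_; inverseˡ; inverseʳ)
open import Function.Bundles using (_⇔_; mk⇔; Equivalence)
open import Relation.Binary.Core using (_Preserves_⟶_)
open import Relation.Binary.Definitions using (tri<; tri≈; tri>)
open import Relation.Binary.PropositionalEquality using (_≡_; refl; sym; trans; cong; subst; subst₂)
open import Axiom.UniquenessOfIdentityProofs using (module Decidable⇒UIP)
open import Data.Empty using (⊥-elim)

successor-<⇒strictlyIncreasing : {k n : ℕ} (g : Fin k → Fin n) →
  (∀ j l → toℕ l ≡ suc (toℕ j) → g j < g l) → g Preserves _<_ ⟶ _<_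
successor-<⇒strictlyIncreasing {zero} g step {()}
successor-<⇒strictlyIncreasing {suc k} g step {j} {l} =
  <-weakInduction (λ l → j < l → g j < g l) (λ ()) extend l
  where
  extend : ∀ i → (j < inject₁ i → g j < g (inject₁ i)) → j < Fin.suc i → g j < g (Fin.suc i)
  extend i ih j<1+i with m<1+n⇒m<n∨m≡n j<1+i
  ... | inj₁ j<i = <-trans (ih (subst (toℕ j ℕ.<_) (sym (toℕ-inject₁ i)) j<i))
                           (step (inject₁ i) (Fin.suc i) (cong suc (sym (toℕ-inject₁ i))))
  ... | inj₂ j≡i = step j (Fin.suc i) (cong suc (sym j≡i))

strictlyIncreasing⇒<-⇔ : {k n : ℕ} {g : Fin k → Fin n} → g Preserves _<_ ⟶ _<_ →
  ∀ {j l} → (g j < g l) ⇔ (j < l)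
strictlyIncreasing⇒<-⇔ {g = g} increasing {j} {l} = mk⇔ reflects increasing
  where
  reflects : g j < g l → j < l
  reflects gj<gl with <-cmp j l
  ... | tri< j<l _ _ = j<l
  ... | tri≈ _ refl _ = ⊥-elim (<-irrefl refl gj<gl)
  ... | tri> _ _ l<j = ⊥-elim (<-asym gj<gl (increasing l<j))

module _ {m : ℕ} (σ : Permutation′ m) where

  pointAt : Fin m → S σ
  pointAt x = (x , σ ⟨$⟩ʳ x) , refl

  pointAtHeight : Fin m → S σ
  pointAtHeight y = (σ ⟨$⟩ˡ y , y) , inverseʳ σ

  px-injective : ∀ {p q} → px σ p ≡ px σ q → p ≡ q
  px-injective {(x , _) , e} {(.x , _) , e′} refl with trans (sym e) e′
  ... | refl with Decidable⇒UIP.≡-irrelevant _≟_ e e′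
  ... | refl = refl

  pointAtHeight-σ : ∀ x → pointAtHeight (σ ⟨$⟩ʳ x) ≡ pointAt x
  pointAtHeight-σ x = px-injective (inverseˡ σ)

module _ {n k : ℕ} (t : Permutation′ n) (π : Permutation′ k) where

  containment⇒validEmbedding : Contains t π → ∃ λ (f : S π → S t) → ValidEmbedding t π f
  containment⇒validEmbedding (i , i-increasing , order) = f , valid
    where
    f : S π → S t
    f p = pointAt t (i (px π p))

    heightOrder : ∀ p q → py π p < py π q → py t (f p) < py t (f q)
    heightOrder p q p<q = Equivalence.from (order (px π p) (px π q))
      (subst₂ _<_ (sym (proj₂ p)) (sym (proj₂ q)) p<q)

    valid : ValidEmbedding t π f
    valid p = (λ q e → i-increasing _ _ (≤-reflexive e))
            , (λ q e → i-increasing _ _ (≤-reflexive (sym e)))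
            , (λ q e → heightOrder q p (≤-reflexive e))
            , (λ q e → heightOrder p q (≤-reflexive (sym e)))

  validEmbedding⇒containment : (∃ λ (f : S π → S t) → ValidEmbedding t π f) → Contains t π
  validEmbedding⇒containment (f , valid) =
    i , (λ _ _ → i-increasing) , λ j l → subst₂ (λ a b → (a < b) ⇔ (π ⟨$⟩ʳ j < π ⟨$⟩ʳ l))
      (sym (t∘i≡h∘π j)) (sym (t∘i≡h∘π l)) (strictlyIncreasing⇒<-⇔ h-increasing)
    where
    i : Fin k → Fin n
    i x = px t (f (pointAt π x))

    h : Fin k → Fin n
    h y = py t (f (pointAtHeight π y))

    i-increasing : i Preserves _<_ ⟶ _<_
    i-increasing = successor-<⇒strictlyIncreasing i
      (λ x x′ e → proj₁ (proj₂ (valid (pointAt π x))) (pointAt π x′) e)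

    h-increasing : h Preserves _<_ ⟶ _<_
    h-increasing = successor-<⇒strictlyIncreasing h
      (λ y y′ e → proj₂ (proj₂ (proj₂ (valid (pointAtHeight π y)))) (pointAtHeight π y′) e)

    t∘i≡h∘π : ∀ x → t ⟨$⟩ʳ i x ≡ h (π ⟨$⟩ʳ x)
    t∘i≡h∘π x = trans (proj₂ (f (pointAt π x)))
      (cong (λ p → py t (f p)) (sym (pointAtHeight-σ π x)))

lemma5 : {n k : ℕ} (t : Permutation′ n) (π : Permutation′ k) →
    Contains t π ⇔ (∃ λ (f : S π → S t) → ValidEmbedding t π f)
lemma5 t π = mk⇔ (containment⇒validEmbedding t π) (validEmbedding⇒containment t π)
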